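{- Let $k\ge 1$ and $n\ge 0$ be integers and let $$D_n(k,x)=\left(\binom{i+k-1}{j+k-1}x^k-\binom{i}{j-1}\right)_{i,j=0}^{n-1}.$$ Then $\det D_n(k,x)=x^nF^{(k)}_{(k-1)n}(x)$.
   Context: Binomial coefficients satisfy $\binom{a}{m}=0$ for $m<0$ and for $m>a\ge 0$, with the usual values otherwise. For a positive integer $k$ and integer $N\ge 0$, the generalized Fibonacci polynomial is $F^{(k)}_N(x)=\sum_{j=0}^{\lfloor N/k\rfloor}\binom{N-(k-1)j}{j}x^{N-kj}$; equivalently $F^{(k)}_N(x)=x^N$ for $0\le N<k$ and $F^{(k)}_N(x)=xF^{(k)}_{N-1}(x)+F^{(k)}_{N-k}(x)$ for $N\ge k$. The determinant of a $0\times 0$ matrix is $1$. -}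

module Defs where

open import Level using (Level)
open import Data.Nat using (ℕ; zero; suc; _∸_; _≤ᵇ_) renaming (_+_ to _+ℕ_; _*_ to _*ℕ_)
open import Data.Bool using (if_then_else_)
open import Data.Fin using (Fin; zero; suc; punchIn; toℕ)
open import Algebra.Bundles using (CommutativeRing)

-- binomial coefficient on naturals (choose n m = 0 for m > n); negative lower
-- indices are handled at the use site.
choose : ℕ → ℕ → ℕ
choose n       zero    = 1
choose zero    (suc m) = 0
choose (suc n) (suc m) = choose n m +ℕ choose n (suc m)

module _ {c ℓ : Level} (R : CommutativeRing c ℓ) where
  open CommutativeRing R using (Carrier; 0#; 1#; _+_; _*_; -_; _-_)

  fromℕ : ℕ → Carrier
  fromℕ zero    = 0#
  fromℕ (suc n) = 1# + fromℕ n

  pow : Carrier → ℕ → Carrier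
  pow x zero    = 1#
  pow x (suc n) = x * pow x n

  ΣFin : (n : ℕ) → (Fin n → Carrier) → Carrier
  ΣFin zero    f = 0#
  ΣFin (suc n) f = f zero + ΣFin n (λ i → f (suc i))

  Σupto : ℕ → (ℕ → Carrier) → Carrier
  Σupto zero    f = f zero
  Σupto (suc N) f = Σupto N f + f (suc N)

  sgn : {n : ℕ} → Fin n → Carrier
  sgn zero    = 1#
  sgn (suc j) = - sgn j

  det : (n : ℕ) → (Fin n → Fin n → Carrier) → Carrier
  det zero    M = 1#
  det (suc n) M =
    ΣFin (suc n) (λ j → sgn j * (M zero j * det n (λ a b → M (suc a) (punchIn j b))))

  -- generalized Fibonacci polynomial evaluated at x:
  -- F^(k)_N(x) = Σ_{j=0}^{⌊N/k⌋} C(N-(k-1)j, j) x^(N-kj); the range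
  -- 0 ≤ j ≤ ⌊N/k⌋ is expressed as  j ≤ N  with  k*j ≤ N  (equivalent for k ≥ 1).
  fib : ℕ → ℕ → Carrier → Carrier
  fib k N x = Σupto N (λ j →
    if (k *ℕ j) ≤ᵇ N
      then fromℕ (choose (N ∸ ((k ∸ 1) *ℕ j)) j) * pow x (N ∸ (k *ℕ j))
      else 0#)

  -- binom(i, j-1) with the convention binom(a, -1) = 0
  chooseShift : ℕ → ℕ → ℕ
  chooseShift i zero    = 0
  chooseShift i (suc j) = choose i j

  Dmat : (k n : ℕ) → Carrier → Fin n → Fin n → Carrier
  Dmat k n x i j =
    fromℕ (choose (Data.Fin.toℕ i +ℕ k ∸ 1) (Data.Fin.toℕ j +ℕ k ∸ 1)) * pow x k
    - fromℕ (chooseShift (Data.Fin.toℕ i) (Data.Fin.toℕ j))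

module Submission where

open import Level using (Level)
open import Data.Bool using (true; false; T; if_then_else_)
open import Data.Empty using (⊥-elim)
open import Data.Fin using (Fin; zero; suc; punchIn; toℕ; inject₁)
open import Data.Fin.Properties using (toℕ<n; toℕ-inject₁)
open import Data.Maybe using (Maybe; just; nothing)
open import Data.Nat as ℕ using (ℕ; zero; suc; _∸_; _≤_; _<_; z≤n; s≤s)
  renaming (_+_ to _+ℕ_; _*_ to _*ℕ_)
import Data.Nat.Properties as ℕ
open import Data.Sum using (inj₁; inj₂)
open import Data.Vec.Functional using (_∷_)
open import Function using (_∘_)
open import Relation.Binary.PropositionalEquality as ≡ using (_≡_)
open import Relation.Nullary using (yes; no)
open import Algebra.Bundles using (CommutativeRing)
import Algebra.Solver.Ring.NaturalCoefficients as NaturalCoefficients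
import Algebra.Properties.Semiring.Mult as SemiringMult

open import Defs

-- With k = K + 1 and X = xᵏ, let Δₙ(v) be det Dₙ with its first column replaced by v.
-- Subtracting from each row the one above it (Pascal's rule) and expanding along the
-- first row gives Δₙ₊₂(v) = v₀ · det Dₙ₊₁ + Δₙ₊₁(∇v) with ∇ the forward difference.
-- The columns i ↦ C(i + K, K − m) X are mapped to one another by ∇, so
-- dₙ = det Dₙ satisfies dₙ₊₁ = Σᵣ C(K, K − r) X dₙ₋ᵣ.  By Vandermonde's convolution
-- gₙ = Σᵢ C(K i, n − i) x^(k i) satisfies the same recursion with g₀ = 1, and gₙ is
-- xⁿ F⁽ᵏ⁾_{K n}(x) after substituting j = n − i in the defining sum.

choose-< : ∀ {a b} → a < b → choose a b ≡ 0
choose-< {zero}  {suc b} _         = ≡.refl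
choose-< {suc a} {suc b} (s≤s a<b) = ≡.cong₂ _+ℕ_ (choose-< a<b) (choose-< (ℕ.m<n⇒m<1+n a<b))

-- chooseDiff a q m is the binomial coefficient C(a, q − m) with an integer lower
-- index, hence 0 when m > q.
chooseDiff : ℕ → ℕ → ℕ → ℕ
chooseDiff a q       zero    = choose a q
chooseDiff a zero    (suc m) = 0
chooseDiff a (suc q) (suc m) = chooseDiff a q m

chooseDiff-< : ∀ a {q m} → q < m → chooseDiff a q m ≡ 0
chooseDiff-< a {zero}  {suc m} _         = ≡.refl
chooseDiff-< a {suc q} {suc m} (s≤s q<m) = chooseDiff-< a q<m

chooseDiff-∸ : ∀ a {r q} m → r ≤ q → chooseDiff a (q ∸ r) m ≡ chooseDiff a q (r +ℕ m)
chooseDiff-∸ a {zero}          m _         = ≡.refl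
chooseDiff-∸ a {suc r} {suc q} m (s≤s r≤q) = chooseDiff-∸ a m r≤q

chooseDiff-≤ : ∀ a {m q} → m ≤ q → chooseDiff a q m ≡ choose a (q ∸ m)
chooseDiff-≤ a {m} {q} m≤q =
  ≡.trans (≡.cong (chooseDiff a q) (≡.sym (ℕ.+-identityʳ m))) (≡.sym (chooseDiff-∸ a 0 m≤q))

chooseDiff-pascal : ∀ a q m →
  chooseDiff (suc a) (suc q) m ≡ chooseDiff a q m +ℕ chooseDiff a (suc q) m
chooseDiff-pascal a q       zero          = ≡.refl
chooseDiff-pascal a zero    (suc zero)    = ≡.refl
chooseDiff-pascal a zero    (suc (suc m)) = ≡.refl
chooseDiff-pascal a (suc q) (suc m)       = chooseDiff-pascal a q m

chooseDiff-suc : ∀ a q m → chooseDiff (suc a) q m ≡ chooseDiff a q (suc m) +ℕ chooseDiff a q m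
chooseDiff-suc a zero    zero    = ≡.refl
chooseDiff-suc a zero    (suc m) = ≡.refl
chooseDiff-suc a (suc q) m       = chooseDiff-pascal a q m

module _ (K i j : ℕ) where
  private
    K[i+j]≡Ki+Kj : K *ℕ (i +ℕ j) ≡ K *ℕ i +ℕ K *ℕ j
    K[i+j]≡Ki+Kj = ℕ.*-distribˡ-+ K i j

  K[i+j]<[1+K]j⇒Ki<j : K *ℕ (i +ℕ j) < suc K *ℕ j → K *ℕ i < j
  K[i+j]<[1+K]j⇒Ki<j lt =
    ℕ.+-cancelʳ-< (K *ℕ j) (K *ℕ i) j (≡.subst (_< j +ℕ K *ℕ j) K[i+j]≡Ki+Kj lt)

  i+j+[K[i+j]∸[1+K]j]≡[1+K]i : suc K *ℕ j ≤ K *ℕ (i +ℕ j) →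
                                i +ℕ j +ℕ (K *ℕ (i +ℕ j) ∸ suc K *ℕ j) ≡ suc K *ℕ i
  i+j+[K[i+j]∸[1+K]j]≡[1+K]i le = begin
    i +ℕ j +ℕ (K *ℕ (i +ℕ j) ∸ (j +ℕ K *ℕ j))
      ≡⟨ ≡.cong (λ t → i +ℕ j +ℕ (t ∸ (j +ℕ K *ℕ j))) K[i+j]≡Ki+Kj ⟩
    i +ℕ j +ℕ (K *ℕ i +ℕ K *ℕ j ∸ (j +ℕ K *ℕ j))
      ≡⟨ ≡.cong (i +ℕ j +ℕ_) (≡.cong₂ _∸_ (ℕ.+-comm (K *ℕ i) (K *ℕ j)) (ℕ.+-comm j (K *ℕ j))) ⟩
    i +ℕ j +ℕ (K *ℕ j +ℕ K *ℕ i ∸ (K *ℕ j +ℕ j))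
      ≡⟨ ≡.cong (i +ℕ j +ℕ_) (ℕ.[m+n]∸[m+o]≡n∸o (K *ℕ j) (K *ℕ i) j) ⟩
    i +ℕ j +ℕ (K *ℕ i ∸ j)
      ≡⟨ ℕ.+-assoc i j _ ⟩
    i +ℕ (j +ℕ (K *ℕ i ∸ j))
      ≡⟨ ≡.cong (i +ℕ_) (ℕ.m+[n∸m]≡n j≤Ki) ⟩
    i +ℕ K *ℕ i ∎
    where
    open ≡.≡-Reasoning
    j≤Ki : j ≤ K *ℕ i
    j≤Ki = ℕ.+-cancelʳ-≤ (K *ℕ j) j (K *ℕ i) (≡.subst (j +ℕ K *ℕ j ≤_) K[i+j]≡Ki+Kj le)

module _ {c ℓ : Level} (R : CommutativeRing c ℓ) where
  open CommutativeRing R hiding (zero)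
  open import Algebra.Properties.Ring ring using (-‿distribˡ-*; -‿distribʳ-*)
  open import Algebra.Properties.AbelianGroup +-abelianGroup
    using (ε⁻¹≈ε; ⁻¹-involutive; ⁻¹-∙-comm; //-rightDividesˡ; //-rightDividesʳ; \\-leftDividesˡ)
  open import Relation.Binary.Reasoning.Setoid setoid
  open SemiringMult semiring using () renaming (_×_ to _×′_)

  private
    ×1-dec : ∀ m n → Maybe (m ×′ 1# ≈ n ×′ 1#)
    ×1-dec m n with m ℕ.≟ n
    ... | yes ≡.refl = just refl
    ... | no _       = nothing

  open NaturalCoefficients commutativeSemiring ×1-dec using (solve; _:=_; _:+_; _:*_)

  -‿*-‿ : ∀ a b → - a * - b ≈ a * b
  -‿*-‿ a b = begin
    - a * - b     ≈⟨ -‿distribˡ-* a (- b) ⟨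
    - (a * - b)   ≈⟨ -‿cong (-‿distribʳ-* a b) ⟨
    - (- (a * b)) ≈⟨ ⁻¹-involutive (a * b) ⟩
    a * b         ∎

  ΣFin-cong : ∀ n {f g : Fin n → Carrier} → (∀ i → f i ≈ g i) → ΣFin R n f ≈ ΣFin R n g
  ΣFin-cong zero    f≈g = refl
  ΣFin-cong (suc n) f≈g = +-cong (f≈g zero) (ΣFin-cong n (f≈g ∘ suc))

  ΣFin-0 : ∀ n {f : Fin n → Carrier} → (∀ i → f i ≈ 0#) → ΣFin R n f ≈ 0#
  ΣFin-0 zero    f≈0 = refl
  ΣFin-0 (suc n) f≈0 = trans (+-cong (f≈0 zero) (ΣFin-0 n (f≈0 ∘ suc))) (+-identityʳ 0#)

  ΣFin-+ : ∀ n (f g : Fin n → Carrier) →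
    ΣFin R n (λ i → f i + g i) ≈ ΣFin R n f + ΣFin R n g
  ΣFin-+ zero    f g = sym (+-identityʳ 0#)
  ΣFin-+ (suc n) f g = trans (+-congˡ (ΣFin-+ n (f ∘ suc) (g ∘ suc)))
    (solve 4 (λ a b c d → (a :+ b) :+ (c :+ d) := (a :+ c) :+ (b :+ d)) refl (f zero) (g zero) _ _)

  ΣFin-*ˡ : ∀ n a (f : Fin n → Carrier) → a * ΣFin R n f ≈ ΣFin R n (λ i → a * f i)
  ΣFin-*ˡ zero    a f = zeroʳ a
  ΣFin-*ˡ (suc n) a f = trans (distribˡ a (f zero) _) (+-congˡ (ΣFin-*ˡ n a (f ∘ suc)))

  ΣFin-neg : ∀ n (f : Fin n → Carrier) → ΣFin R n (λ i → - f i) ≈ - ΣFin R n f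
  ΣFin-neg zero    f = sym ε⁻¹≈ε
  ΣFin-neg (suc n) f = trans (+-congˡ (ΣFin-neg n (f ∘ suc))) (⁻¹-∙-comm (f zero) _)

  ΣFin-swap : ∀ n m (f : Fin n → Fin m → Carrier) →
    ΣFin R n (λ a → ΣFin R m (f a)) ≈ ΣFin R m (λ b → ΣFin R n (λ a → f a b))
  ΣFin-swap zero    m f = sym (ΣFin-0 m (λ _ → refl))
  ΣFin-swap (suc n) m f = trans (+-congˡ (ΣFin-swap n m (f ∘ suc)))
    (sym (ΣFin-+ m (f zero) (λ b → ΣFin R n (λ a → f (suc a) b))))

  ΣFin-cancel : ∀ n (f g : Fin n → Carrier) →
    ΣFin R n f + ΣFin R n (λ i → - f i + g i) ≈ ΣFin R n g
  ΣFin-cancel n f g = begin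
    ΣFin R n f + ΣFin R n (λ i → - f i + g i)        ≈⟨ +-congˡ (ΣFin-+ n _ g) ⟩
    ΣFin R n f + (ΣFin R n (λ i → - f i) + ΣFin R n g) ≈⟨ +-congˡ (+-congʳ (ΣFin-neg n f)) ⟩
    ΣFin R n f + (- ΣFin R n f + ΣFin R n g)         ≈⟨ \\-leftDividesˡ _ _ ⟩
    ΣFin R n g                                       ∎

  minor : ∀ {n} → (Fin (suc n) → Fin (suc n) → Carrier) → Fin (suc n) → Fin n → Fin n → Carrier
  minor M j a b = M (suc a) (punchIn j b)

  det-cong : ∀ n {M N : Fin n → Fin n → Carrier} → (∀ i j → M i j ≈ N i j) → det R n M ≈ det R n N
  det-cong zero    M≈N = refl
  det-cong (suc n) M≈N = ΣFin-cong (suc n) (λ j →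
    *-congˡ {sgn R j} (*-cong (M≈N zero j) (det-cong n (λ a b → M≈N (suc a) (punchIn j b)))))

  -- expand₂ n u W is the Laplace expansion along the first two rows of a matrix
  -- whose first two rows are both u, W φ being the minor on the columns φ.
  expand₂ : ∀ n → (Fin (suc (suc n)) → Carrier) → ((Fin n → Fin (suc (suc n))) → Carrier) → Carrier
  expand₂ n u W = ΣFin R (suc (suc n)) (λ j → sgn R j * (u j * ΣFin R (suc n) (λ j′ →
    sgn R j′ * (u (punchIn j j′) * W (punchIn j ∘ punchIn j′)))))

  expand₂-tail : ∀ n → (Fin (suc (suc n)) → Carrier) → ((Fin n → Fin (suc (suc n))) → Carrier) →
                 Carrier
  expand₂-tail n u W = ΣFin R (suc n) (λ j → sgn R j * (u (suc j) * ΣFin R n (λ j′ →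
    sgn R j′ * (u (suc (punchIn j j′)) * W (punchIn (suc j) ∘ punchIn (suc j′))))))

  -- The terms using column 0 in either row cancel in pairs.
  expand₂≈tail : ∀ n u W → expand₂ n u W ≈ expand₂-tail n u W
  expand₂≈tail n u W = begin
    expand₂ n u W
      ≈⟨ +-cong head≈ (ΣFin-cong (suc n) rest≈) ⟩
    ΣFin R (suc n) P + ΣFin R (suc n) (λ j → - P j + sgn R j * (u (suc j) * S j))
      ≈⟨ ΣFin-cancel (suc n) P (λ j → sgn R j * (u (suc j) * S j)) ⟩
    expand₂-tail n u W ∎
    where
    X : Fin (suc n) → Carrier
    X j = W (suc ∘ punchIn j)
    P : Fin (suc n) → Carrier
    P j = sgn R j * (u (suc j) * (u zero * X j))
    S : Fin (suc n) → Carrier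
    S j = ΣFin R n (λ j′ → sgn R j′ * (u (suc (punchIn j j′)) * W (punchIn (suc j) ∘ punchIn (suc j′))))
    head≈ : 1# * (u zero * ΣFin R (suc n) (λ j → sgn R j * (u (suc j) * X j))) ≈ ΣFin R (suc n) P
    head≈ = trans (*-identityˡ _) (trans (ΣFin-*ˡ (suc n) (u zero) (λ j → sgn R j * (u (suc j) * X j)))
      (ΣFin-cong (suc n) (λ j → solve 4 (λ a s b x → a :* (s :* (b :* x)) := s :* (b :* (a :* x)))
                                        refl (u zero) (sgn R j) (u (suc j)) (X j))))
    rest≈ : ∀ j → - sgn R j * (u (suc j) * (1# * (u zero * X j) + ΣFin R n (λ j′ → - sgn R j′ *
              (u (suc (punchIn j j′)) * W (punchIn (suc j) ∘ punchIn (suc j′))))))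
            ≈ - P j + sgn R j * (u (suc j) * S j)
    rest≈ j = begin
      - s * (a * (1# * y + Q))  ≈⟨ *-congˡ (*-congˡ (+-cong (*-identityˡ y) Q≈)) ⟩
      - s * (a * (y + - S j))   ≈⟨ *-congˡ (distribˡ a y (- S j)) ⟩
      - s * (a * y + a * - S j) ≈⟨ distribˡ (- s) _ _ ⟩
      - s * (a * y) + - s * (a * - S j)
        ≈⟨ +-cong (sym (-‿distribˡ-* s _)) (*-congˡ (sym (-‿distribʳ-* a (S j)))) ⟩
      - (s * (a * y)) + - s * - (a * S j) ≈⟨ +-congˡ (-‿*-‿ s _) ⟩
      - P j + s * (a * S j)     ∎
      where
      s = sgn R j
      a = u (suc j)
      y = u zero * X j
      Q = ΣFin R n (λ j′ → - sgn R j′ * (u (suc (punchIn j j′)) * W (punchIn (suc j) ∘ punchIn (suc j′))))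
      Q≈ : Q ≈ - S j
      Q≈ = trans (ΣFin-cong n (λ j′ → sym (-‿distribˡ-* _ _))) (ΣFin-neg n _)

  Extensional : ∀ {n m} → ((Fin n → Fin m) → Carrier) → Set _
  Extensional W = ∀ {φ ψ} → (∀ c → φ c ≡ ψ c) → W φ ≈ W ψ

  liftFin : ∀ {n m} → (Fin n → Fin m) → Fin (suc n) → Fin (suc m)
  liftFin φ = zero ∷ suc ∘ φ

  expand₂-tail-suc : ∀ n u W → Extensional W →
    expand₂-tail (suc n) u W ≈ expand₂ n (u ∘ suc) (W ∘ liftFin)
  expand₂-tail-suc n u W ext = ΣFin-cong (suc (suc n)) (λ j → *-congˡ {sgn R j} (*-congˡ {u (suc j)}
    (ΣFin-cong (suc n) (λ j′ → *-congˡ {sgn R j′} (*-congˡ {u (suc (punchIn j j′))}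
      (ext {punchIn (suc j) ∘ punchIn (suc j′)} {liftFin (punchIn j ∘ punchIn j′)}
           (λ { zero → ≡.refl ; (suc c) → ≡.refl })))))))

  expand₂≈0 : ∀ n u W → Extensional W → expand₂ n u W ≈ 0#
  expand₂≈0 zero u W _ = trans (expand₂≈tail zero u W)
    (ΣFin-0 1 (λ j → trans (*-congˡ {sgn R j} (zeroʳ (u (suc j)))) (zeroʳ (sgn R j))))
  expand₂≈0 (suc n) u W ext = begin
    expand₂ (suc n) u W                  ≈⟨ expand₂≈tail (suc n) u W ⟩
    expand₂-tail (suc n) u W             ≈⟨ expand₂-tail-suc n u W ext ⟩
    expand₂ n (u ∘ suc) (W ∘ liftFin)    ≈⟨ expand₂≈0 n (u ∘ suc) (W ∘ liftFin) ext′ ⟩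
    0#                                   ∎
    where
    ext′ : Extensional (W ∘ liftFin)
    ext′ φ≗ψ = ext (λ { zero → ≡.refl ; (suc c) → ≡.cong suc (φ≗ψ c) })

  det-equalRows : ∀ n (u : Fin (suc (suc n)) → Carrier) B → det R (suc (suc n)) (u ∷ u ∷ B) ≈ 0#
  det-equalRows n u B = expand₂≈0 n u (λ φ → det R n (λ a b → B a (φ b)))
    (λ φ≗ψ → det-cong n (λ a b → reflexive (≡.cong (B a) (φ≗ψ b))))

  det-linear₀ : ∀ n (u v : Fin (suc n) → Carrier) a B →
    det R (suc n) ((λ j → u j + a * v j) ∷ B) ≈ det R (suc n) (u ∷ B) + a * det R (suc n) (v ∷ B)
  det-linear₀ n u v a B = begin
    ΣFin R (suc n) (λ j → sgn R j * ((u j + a * v j) * D j))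
      ≈⟨ ΣFin-cong (suc n) (λ j → solve 5 (λ s u a v d → s :* ((u :+ a :* v) :* d)
                                                      := s :* (u :* d) :+ a :* (s :* (v :* d)))
                                       refl (sgn R j) (u j) a (v j) (D j)) ⟩
    ΣFin R (suc n) (λ j → sgn R j * (u j * D j) + a * (sgn R j * (v j * D j)))
      ≈⟨ ΣFin-+ (suc n) (λ j → sgn R j * (u j * D j)) (λ j → a * (sgn R j * (v j * D j))) ⟩
    ΣFin R (suc n) (λ j → sgn R j * (u j * D j)) + ΣFin R (suc n) (λ j → a * (sgn R j * (v j * D j)))
      ≈⟨ +-congˡ (ΣFin-*ˡ (suc n) a (λ j → sgn R j * (v j * D j))) ⟨
    ΣFin R (suc n) (λ j → sgn R j * (u j * D j)) + a * ΣFin R (suc n) (λ j → sgn R j * (v j * D j)) ∎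
    where
    D : Fin (suc n) → Carrier
    D j = det R n (λ a b → B a (punchIn j b))

  det-addRow₀ : ∀ n (r₀ r₁ : Fin (suc (suc n)) → Carrier) a B →
    det R (suc (suc n)) (r₀ ∷ (λ j → r₁ j + a * r₀ j) ∷ B) ≈ det R (suc (suc n)) (r₀ ∷ r₁ ∷ B)
  det-addRow₀ n r₀ r₁ a B = begin
    det R (suc (suc n)) (r₀ ∷ (λ j → r₁ j + a * r₀ j) ∷ B)
      ≈⟨ ΣFin-cong (suc (suc n)) (λ j → *-congˡ {sgn R j} (*-congˡ {r₀ j}
           (det-linear₀ n (r₁ ∘ punchIn j) (r₀ ∘ punchIn j) a (B′ j)))) ⟩
    ΣFin R (suc (suc n)) (λ j → sgn R j * (r₀ j * (D₁ j + a * D₀ j)))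
      ≈⟨ ΣFin-cong (suc (suc n)) (λ j → solve 5 (λ s r d a e → s :* (r :* (d :+ a :* e))
                                                            := s :* (r :* d) :+ a :* (s :* (r :* e)))
                                             refl (sgn R j) (r₀ j) (D₁ j) a (D₀ j)) ⟩
    ΣFin R (suc (suc n)) (λ j → sgn R j * (r₀ j * D₁ j) + a * (sgn R j * (r₀ j * D₀ j)))
      ≈⟨ ΣFin-+ (suc (suc n)) (λ j → sgn R j * (r₀ j * D₁ j)) (λ j → a * (sgn R j * (r₀ j * D₀ j))) ⟩
    det R (suc (suc n)) (r₀ ∷ r₁ ∷ B) + ΣFin R (suc (suc n)) (λ j → a * (sgn R j * (r₀ j * D₀ j)))
      ≈⟨ +-congˡ (ΣFin-*ˡ (suc (suc n)) a (λ j → sgn R j * (r₀ j * D₀ j))) ⟨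
    det R (suc (suc n)) (r₀ ∷ r₁ ∷ B) + a * det R (suc (suc n)) (r₀ ∷ r₀ ∷ B)
      ≈⟨ +-congˡ (trans (*-congˡ (det-equalRows n r₀ B)) (zeroʳ a)) ⟩
    det R (suc (suc n)) (r₀ ∷ r₁ ∷ B) + 0#
      ≈⟨ +-identityʳ _ ⟩
    det R (suc (suc n)) (r₀ ∷ r₁ ∷ B) ∎
    where
    B′ : Fin (suc (suc n)) → Fin n → Fin (suc n) → Carrier
    B′ j a b = B a (punchIn j b)
    D₀ D₁ : Fin (suc (suc n)) → Carrier
    D₀ j = det R (suc n) ((r₀ ∘ punchIn j) ∷ B′ j)
    D₁ j = det R (suc n) ((r₁ ∘ punchIn j) ∷ B′ j)

  det-rowDifferences : ∀ n (M N : Fin (suc n) → Fin (suc n) → Carrier) →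
    (∀ j → N zero j ≈ M zero j) → (∀ i j → N (suc i) j ≈ M (suc i) j - M (inject₁ i) j) →
    det R (suc n) N ≈ det R (suc n) M
  det-rowDifferences zero    M N N₀≈ _ = det-cong 1 {N} {M} (λ { zero j → N₀≈ j })
  det-rowDifferences (suc n) M N N₀≈ N₊≈ = begin
    det R (suc (suc n)) N
      ≈⟨ det-addRow₀ n (N zero) (N (suc zero)) 1# (λ i → N (suc (suc i))) ⟨
    det R (suc (suc n)) N′
      ≈⟨ ΣFin-cong (suc (suc n)) (λ j → *-congˡ {sgn R j} (*-cong (N₀≈ j)
           (det-rowDifferences n (minor M j) (minor N′ j)
             (λ b → row₁≈ (punchIn j b)) (λ i b → N₊≈ (suc i) (punchIn j b))))) ⟩
    det R (suc (suc n)) M ∎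
    where
    N′ : Fin (suc (suc n)) → Fin (suc (suc n)) → Carrier
    N′ = N zero ∷ (λ j → N (suc zero) j + 1# * N zero j) ∷ λ i → N (suc (suc i))
    row₁≈ : ∀ j → N (suc zero) j + 1# * N zero j ≈ M (suc zero) j
    row₁≈ j = begin
      N (suc zero) j + 1# * N zero j        ≈⟨ +-cong (N₊≈ zero j) (trans (*-identityˡ _) (N₀≈ j)) ⟩
      (M (suc zero) j - M zero j) + M zero j ≈⟨ //-rightDividesˡ (M zero j) (M (suc zero) j) ⟩
      M (suc zero) j                         ∎

  ι : ℕ → Carrier
  ι = fromℕ R

  infixr 8 _^_
  _^_ : Carrier → ℕ → Carrier
  _^_ = pow R

  ι-cong : ∀ {m n} → m ≡ n → ι m ≈ ι n
  ι-cong m≡n = reflexive (≡.cong ι m≡n)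

  ι-+ : ∀ m n → ι (m +ℕ n) ≈ ι m + ι n
  ι-+ zero    n = sym (+-identityˡ (ι n))
  ι-+ (suc m) n = trans (+-congˡ (ι-+ m n)) (sym (+-assoc 1# (ι m) (ι n)))

  ^-distribˡ-+-* : ∀ x m n → x ^ (m +ℕ n) ≈ x ^ m * x ^ n
  ^-distribˡ-+-* x zero    n = sym (*-identityˡ (x ^ n))
  ^-distribˡ-+-* x (suc m) n = trans (*-congˡ (^-distribˡ-+-* x m n)) (sym (*-assoc x (x ^ m) (x ^ n)))

  ι-choose-suc : ∀ a q → ι (choose (suc a) q) ≈ ι (chooseShift R a q) + ι (choose a q)
  ι-choose-suc a zero    = sym (+-identityˡ (ι 1))
  ι-choose-suc a (suc q) = ι-+ (choose a q) (choose a (suc q))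

  Σ< : ℕ → (ℕ → Carrier) → Carrier
  Σ< n f = ΣFin R n (f ∘ toℕ)

  Σ<-cong< : ∀ n {f g : ℕ → Carrier} → (∀ i → i < n → f i ≈ g i) → Σ< n f ≈ Σ< n g
  Σ<-cong< n f≈g = ΣFin-cong n (λ i → f≈g (toℕ i) (toℕ<n i))

  Σ<-cong : ∀ n {f g : ℕ → Carrier} → (∀ i → f i ≈ g i) → Σ< n f ≈ Σ< n g
  Σ<-cong n f≈g = ΣFin-cong n (f≈g ∘ toℕ)

  Σ<-+ : ∀ n (f g : ℕ → Carrier) → Σ< n (λ i → f i + g i) ≈ Σ< n f + Σ< n g
  Σ<-+ n f g = ΣFin-+ n (f ∘ toℕ) (g ∘ toℕ)

  Σ<-*ˡ : ∀ n a (f : ℕ → Carrier) → a * Σ< n f ≈ Σ< n (λ i → a * f i)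
  Σ<-*ˡ n a f = ΣFin-*ˡ n a (f ∘ toℕ)

  Σ<-swap : ∀ n m (f : ℕ → ℕ → Carrier) →
            Σ< n (λ a → Σ< m (f a)) ≈ Σ< m (λ b → Σ< n (λ a → f a b))
  Σ<-swap n m f = ΣFin-swap n m (λ a b → f (toℕ a) (toℕ b))

  Σ<-0 : ∀ n {f : ℕ → Carrier} → (∀ i → f i ≈ 0#) → Σ< n f ≈ 0#
  Σ<-0 n f≈0 = ΣFin-0 n (f≈0 ∘ toℕ)

  Σ<-zeros : ∀ n d (f : ℕ → Carrier) → (∀ i → n ≤ i → f i ≈ 0#) → Σ< (n +ℕ d) f ≈ Σ< n f
  Σ<-zeros zero    d f f≈0 = Σ<-0 d (λ i → f≈0 i z≤n)
  Σ<-zeros (suc n) d f f≈0 = +-congˡ (Σ<-zeros n d (f ∘ suc) (λ i n≤i → f≈0 (suc i) (s≤s n≤i)))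

  Σupto-reverse : ∀ n (f : ℕ → Carrier) → Σupto R n f ≈ Σ< (suc n) (λ i → f (n ∸ i))
  Σupto-reverse zero    f = sym (+-identityʳ (f 0))
  Σupto-reverse (suc n) f = trans (+-congʳ (Σupto-reverse n f)) (+-comm _ (f (suc n)))

  Σupto-zeros : ∀ {m} n (f : ℕ → Carrier) → m ≤ n → (∀ j → m < j → f j ≈ 0#) →
                Σupto R n f ≈ Σupto R m f
  Σupto-zeros zero    f z≤n _ = refl
  Σupto-zeros (suc n) f m≤1+n f≈0 with ℕ.m≤n⇒m<n∨m≡n m≤1+n
  ... | inj₁ m<1+n  = trans (+-cong (Σupto-zeros n f (ℕ.≤-pred m<1+n) f≈0) (f≈0 (suc n) m<1+n))
                            (+-identityʳ _)
  ... | inj₂ ≡.refl = refl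

  vandermonde : ∀ a b q L → q < L →
    Σ< L (λ m → ι (chooseDiff a a m) * ι (chooseDiff b q m)) ≈ ι (choose (a +ℕ b) q)
  vandermonde zero b q (suc L) _ = begin
    ι 1 * ι (choose b q) + Σ< L (λ m → 0# * ι (chooseDiff b q (suc m)))
      ≈⟨ +-cong (trans (*-congʳ (+-identityʳ 1#)) (*-identityˡ _))
                (Σ<-0 L (λ m → zeroˡ (ι (chooseDiff b q (suc m))))) ⟩
    ι (choose b q) + 0# ≈⟨ +-identityʳ _ ⟩
    ι (choose b q)      ∎
  vandermonde (suc a) b q (suc L) q<1+L = begin
    Σ< (suc L) (λ m → ι (chooseDiff (suc a) (suc a) m) * B m)
      ≈⟨ Σ<-cong (suc L) (λ m → trans (*-congʳ {B m} (trans (ι-cong (chooseDiff-pascal a a m))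
                                                             (ι-+ (chooseDiff a a m) (chooseDiff a (suc a) m))))
                                       (distribʳ (B m) _ _)) ⟩
    Σ< (suc L) (λ m → A₀ m * B m + A₁ m * B m)
      ≈⟨ Σ<-+ (suc L) (λ m → A₀ m * B m) (λ m → A₁ m * B m) ⟩
    Σ< (suc L) (λ m → A₀ m * B m) + Σ< (suc L) (λ m → A₁ m * B m)
      ≈⟨ +-cong (vandermonde a b q (suc L) q<1+L) (shifted q q<1+L) ⟩
    ι (choose (a +ℕ b) q) + ι (chooseShift R (a +ℕ b) q)
      ≈⟨ trans (+-comm _ _) (sym (ι-choose-suc (a +ℕ b) q)) ⟩
    ι (choose (suc a +ℕ b) q) ∎
    where
    A₀ A₁ B : ℕ → Carrier
    A₀ m = ι (chooseDiff a a m)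
    A₁ m = ι (chooseDiff a (suc a) m)
    B m = ι (chooseDiff b q m)
    first≈0 : ι (chooseDiff a (suc a) 0) ≈ 0#
    first≈0 = ι-cong (choose-< (ℕ.n<1+n a))
    shifted : ∀ q → q < suc L →
      Σ< (suc L) (λ m → A₁ m * ι (chooseDiff b q m)) ≈ ι (chooseShift R (a +ℕ b) q)
    shifted zero    _         = trans (+-cong (trans (*-congʳ first≈0) (zeroˡ _)) (Σ<-0 L (λ m → zeroʳ (A₁ (suc m)))))
                                      (+-identityʳ 0#)
    shifted (suc q) (s≤s q<L) = trans (+-cong (trans (*-congʳ first≈0) (zeroˡ _)) (vandermonde a b q L q<L))
                                      (+-identityˡ _)

  module _ (K : ℕ) (x : Carrier) where

    X : Carrier
    X = x ^ suc K

    infix 10 X^_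
    X^_ : ℕ → Carrier
    X^ i = x ^ (suc K *ℕ i)

    entry : ℕ → ℕ → Carrier
    entry i c = ι (choose (i +ℕ K) (c +ℕ K)) * X - ι (chooseShift R i c)

    entry-pascal : ∀ i c → entry (suc i) (suc c) - entry i (suc c) ≈ entry i c
    entry-pascal i c = begin
      (ι (choose (suc (i +ℕ K)) (suc (c +ℕ K))) * X - ι (choose (suc i) c)) - (B * X - Q)
        ≈⟨ +-congʳ (+-cong (*-congʳ (ι-+ (choose (i +ℕ K) (c +ℕ K)) (choose (i +ℕ K) (suc (c +ℕ K)))))
                           (-‿cong (ι-choose-suc i c))) ⟩
      ((A + B) * X - (P + Q)) - (B * X - Q)
        ≈⟨ +-congʳ (+-congˡ (sym (⁻¹-∙-comm P Q))) ⟩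
      ((A + B) * X + (- P + - Q)) - (B * X - Q)
        ≈⟨ +-congʳ (solve 5 (λ A B X p q → (A :+ B) :* X :+ (p :+ q) := (A :* X :+ p) :+ (B :* X :+ q))
                            refl A B X (- P) (- Q)) ⟩
      ((A * X - P) + (B * X - Q)) - (B * X - Q)
        ≈⟨ //-rightDividesʳ (B * X - Q) (A * X - P) ⟩
      A * X - P ∎
      where
      A = ι (choose (i +ℕ K) (c +ℕ K))
      B = ι (choose (i +ℕ K) (suc (c +ℕ K)))
      P = ι (chooseShift R i c)
      Q = ι (choose i c)

    entry₀₁ : entry 0 1 ≈ - 1#
    entry₀₁ = begin
      ι (choose K (suc K)) * X - ι 1 ≈⟨ +-cong (trans (*-congʳ (ι-cong (choose-< (ℕ.n<1+n K)))) (zeroˡ X))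
                                                (-‿cong (+-identityʳ 1#)) ⟩
      0# - 1#                        ≈⟨ +-identityˡ (- 1#) ⟩
      - 1#                           ∎

    entry₀-vanishes : ∀ c → entry 0 (suc (suc c)) ≈ 0#
    entry₀-vanishes c = begin
      ι (choose K (suc (suc c) +ℕ K)) * X - 0#
        ≈⟨ +-cong (trans (*-congʳ (ι-cong (choose-< (s≤s (ℕ.m≤n+m K (suc c)))))) (zeroˡ X)) ε⁻¹≈ε ⟩
      0# + 0# ≈⟨ +-identityʳ 0# ⟩
      0#      ∎

    entryWith : (ℕ → Carrier) → ℕ → ℕ → Carrier
    entryWith v i zero    = v i
    entryWith v i (suc c) = entry i (suc c)

    detWith : ℕ → (ℕ → Carrier) → Carrier
    detWith n v = det R n (λ i j → entryWith v (toℕ i) (toℕ j))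

    firstColumn : ℕ → Carrier
    firstColumn i = entry i 0

    detD : ℕ → Carrier
    detD n = detWith n firstColumn

    entry≈entryWith : ∀ i c → entry i c ≈ entryWith firstColumn i c
    entry≈entryWith i zero    = refl
    entry≈entryWith i (suc c) = refl

    detWith-cong : ∀ n {v w} → (∀ i → v i ≈ w i) → detWith n v ≈ detWith n w
    detWith-cong n {v} {w} v≈w = det-cong n (λ i j → entryWith-cong (toℕ i) (toℕ j))
      where
      entryWith-cong : ∀ i c → entryWith v i c ≈ entryWith w i c
      entryWith-cong i zero    = v≈w i
      entryWith-cong i (suc c) = refl

    detWith-1 : ∀ v → detWith 1 v ≈ v 0
    detWith-1 v = trans (+-identityʳ _) (trans (*-identityˡ _) (*-identityʳ (v 0)))

    forwardDifference : (ℕ → Carrier) → ℕ → Carrier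
    forwardDifference v i = v (suc i) - v i

    differenceRow : (ℕ → Carrier) → ℕ → ℕ → Carrier
    differenceRow v i zero    = forwardDifference v i
    differenceRow v i (suc c) = entry i c

    -- detWith n v after subtracting from each row the one above it (entry-pascal).
    differenced : ∀ n → (ℕ → Carrier) → Fin (suc n) → Fin (suc n) → Carrier
    differenced n v = (λ j → entryWith v 0 (toℕ j)) ∷ λ i j → differenceRow v (toℕ i) (toℕ j)

    det-differenced : ∀ n v → det R (suc n) (differenced n v) ≈ detWith (suc n) v
    det-differenced n v = det-rowDifferences n (λ i j → entryWith v (toℕ i) (toℕ j)) (differenced n v)
                                             (λ _ → refl) rows≈
      where
      differenceRow≈ : ∀ i c → differenceRow v i c ≈ entryWith v (suc i) c - entryWith v i c
      differenceRow≈ i zero    = refl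
      differenceRow≈ i (suc c) = sym (entry-pascal i c)
      rows≈ : ∀ i j → differenceRow v (toℕ i) (toℕ j)
                      ≈ entryWith v (suc (toℕ i)) (toℕ j) - entryWith v (toℕ (inject₁ i)) (toℕ j)
      rows≈ i j rewrite toℕ-inject₁ i = differenceRow≈ (toℕ i) (toℕ j)

    -- The first row is (v 0, −1, 0, 0, …), so only two terms of the expansion survive.
    det-differenced-expand : ∀ n v →
      det R (suc (suc n)) (differenced (suc n) v) ≈ v 0 * detD (suc n) + detWith (suc n) (forwardDifference v)
    det-differenced-expand n v = begin
      det R (suc (suc n)) N
        ≈⟨ +-cong column₀ (+-cong column₁ (ΣFin-0 n column₂₊)) ⟩
      v 0 * detD (suc n) + (detWith (suc n) (forwardDifference v) + 0#)
        ≈⟨ +-congˡ (+-identityʳ _) ⟩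
      v 0 * detD (suc n) + detWith (suc n) (forwardDifference v) ∎
      where
      N = differenced (suc n) v
      column₀ : 1# * (v 0 * det R (suc n) (minor N zero)) ≈ v 0 * detD (suc n)
      column₀ = trans (*-identityˡ _)
                      (*-congˡ (det-cong (suc n) {minor N zero} (λ a b → entry≈entryWith (toℕ a) (toℕ b))))
      column₁ : - 1# * (entry 0 1 * det R (suc n) (minor N (suc zero))) ≈ detWith (suc n) (forwardDifference v)
      column₁ = begin
        - 1# * (entry 0 1 * det R (suc n) (minor N (suc zero)))
          ≈⟨ *-congˡ (*-cong entry₀₁ (det-cong (suc n) {minor N (suc zero)}
                                                {λ i j → entryWith (forwardDifference v) (toℕ i) (toℕ j)}
                                                (λ { a zero → refl ; a (suc b) → refl }))) ⟩
        - 1# * (- 1# * detWith (suc n) (forwardDifference v))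
          ≈⟨ trans (sym (*-assoc _ _ _)) (*-congʳ (trans (-‿*-‿ 1# 1#) (*-identityˡ 1#))) ⟩
        1# * detWith (suc n) (forwardDifference v)
          ≈⟨ *-identityˡ _ ⟩
        detWith (suc n) (forwardDifference v) ∎
      column₂₊ : ∀ (j : Fin n) →
        sgn R (suc (suc j)) * (entry 0 (suc (suc (toℕ j))) * det R (suc n) (minor N (suc (suc j)))) ≈ 0#
      column₂₊ j = trans (*-congˡ (trans (*-congʳ (entry₀-vanishes (toℕ j))) (zeroˡ _))) (zeroʳ _)

    detWith-suc : ∀ n v → detWith (suc (suc n)) v ≈ v 0 * detD (suc n) + detWith (suc n) (forwardDifference v)
    detWith-suc n v = trans (sym (det-differenced (suc n) v)) (det-differenced-expand n v)

    binomialColumn : ℕ → ℕ → Carrier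
    binomialColumn m i = ι (chooseDiff (i +ℕ K) K m) * X

    forwardDifference-binomialColumn : ∀ m i → forwardDifference (binomialColumn m) i ≈ binomialColumn (suc m) i
    forwardDifference-binomialColumn m i = begin
      ι (chooseDiff (suc (i +ℕ K)) K m) * X - binomialColumn m i
        ≈⟨ +-congʳ (*-congʳ (trans (ι-cong (chooseDiff-suc (i +ℕ K) K m))
                                   (ι-+ (chooseDiff (i +ℕ K) K (suc m)) (chooseDiff (i +ℕ K) K m)))) ⟩
      (ι (chooseDiff (i +ℕ K) K (suc m)) + ι (chooseDiff (i +ℕ K) K m)) * X - binomialColumn m i
        ≈⟨ +-congʳ (distribʳ X _ _) ⟩
      (binomialColumn (suc m) i + binomialColumn m i) - binomialColumn m i
        ≈⟨ //-rightDividesʳ (binomialColumn m i) (binomialColumn (suc m) i) ⟩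
      binomialColumn (suc m) i ∎

    detWith-binomialColumn : ∀ n m →
      detWith (suc n) (binomialColumn m) ≈ Σ< (suc n) (λ r → binomialColumn (m +ℕ r) 0 * detD (n ∸ r))
    detWith-binomialColumn zero m = begin
      detWith 1 (binomialColumn m)              ≈⟨ detWith-1 (binomialColumn m) ⟩
      binomialColumn m 0                        ≡⟨ ≡.cong (λ t → binomialColumn t 0) (ℕ.+-identityʳ m) ⟨
      binomialColumn (m +ℕ 0) 0                 ≈⟨ *-identityʳ _ ⟨
      binomialColumn (m +ℕ 0) 0 * detD 0        ≈⟨ +-identityʳ _ ⟨
      Σ< 1 (λ r → binomialColumn (m +ℕ r) 0 * detD (0 ∸ r)) ∎
    detWith-binomialColumn (suc n) m = begin
      detWith (suc (suc n)) (binomialColumn m)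
        ≈⟨ detWith-suc n (binomialColumn m) ⟩
      binomialColumn m 0 * detD (suc n) + detWith (suc n) (forwardDifference (binomialColumn m))
        ≈⟨ +-cong (*-congʳ (reflexive (≡.cong (λ t → binomialColumn t 0) (≡.sym (ℕ.+-identityʳ m)))))
                  (trans (detWith-cong (suc n) (forwardDifference-binomialColumn m))
                         (detWith-binomialColumn n (suc m))) ⟩
      binomialColumn (m +ℕ 0) 0 * detD (suc n)
        + Σ< (suc n) (λ r → binomialColumn (suc m +ℕ r) 0 * detD (n ∸ r))
        ≈⟨ +-congˡ (Σ<-cong (suc n) (λ r → *-congʳ {detD (n ∸ r)}
                                              (reflexive (≡.cong (λ t → binomialColumn t 0) (ℕ.+-suc m r))))) ⟨
      Σ< (suc (suc n)) (λ r → binomialColumn (m +ℕ r) 0 * detD (suc n ∸ r)) ∎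

    detD-recurrence : ∀ n → detD (suc n) ≈ Σ< (suc n) (λ r → binomialColumn r 0 * detD (n ∸ r))
    detD-recurrence n = trans (detWith-cong (suc n) (λ i → trans (+-congˡ ε⁻¹≈ε) (+-identityʳ _)))
                              (detWith-binomialColumn n 0)

    closedForm : ℕ → Carrier
    closedForm n = Σ< (suc n) (λ i → ι (chooseDiff (K *ℕ i) n i) * X^ i)

    closedForm-0 : closedForm 0 ≈ 1#
    closedForm-0 = trans (+-identityʳ _)
      (trans (*-cong (+-identityʳ 1#) (reflexive (≡.cong (x ^_) (ℕ.*-zeroʳ (suc K))))) (*-identityˡ 1#))

    closedForm-∸ : ∀ n r → r ≤ n →
      closedForm (n ∸ r) ≈ Σ< (suc n) (λ i → ι (chooseDiff (K *ℕ i) n (r +ℕ i)) * X^ i)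
    closedForm-∸ n r r≤n = begin
      closedForm (n ∸ r)
        ≈⟨ Σ<-zeros (suc (n ∸ r)) r term (λ i n∸r<i → trans (*-congʳ (ι-cong (chooseDiff-< (K *ℕ i) n∸r<i)))
                                                           (zeroˡ _)) ⟨
      Σ< (suc (n ∸ r) +ℕ r) term
        ≡⟨ ≡.cong (λ t → Σ< (suc t) term) (ℕ.m∸n+n≡m r≤n) ⟩
      Σ< (suc n) term
        ≈⟨ Σ<-cong (suc n) (λ i → *-congʳ {X^ i} (ι-cong (chooseDiff-∸ (K *ℕ i) i r≤n))) ⟩
      Σ< (suc n) (λ i → ι (chooseDiff (K *ℕ i) n (r +ℕ i)) * X^ i) ∎
      where
      term : ℕ → Carrier
      term i = ι (chooseDiff (K *ℕ i) (n ∸ r) i) * X^ i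

    closedForm-suc : ∀ n →
      closedForm (suc n) ≈ Σ< (suc n) (λ i → (X * X^ i) * ι (chooseDiff (K +ℕ K *ℕ i) n i))
    closedForm-suc n = trans (+-cong first≈0 (Σ<-cong (suc n) shift)) (+-identityˡ _)
      where
      first≈0 : ι (chooseDiff (K *ℕ 0) (suc n) 0) * X^ 0 ≈ 0#
      first≈0 = trans (*-congʳ (reflexive (≡.cong (λ t → ι (choose t (suc n))) (ℕ.*-zeroʳ K)))) (zeroˡ _)
      shift : ∀ i → ι (chooseDiff (K *ℕ suc i) (suc n) (suc i)) * X^ (suc i)
                    ≈ (X * X^ i) * ι (chooseDiff (K +ℕ K *ℕ i) n i)
      shift i = trans (*-cong (reflexive (≡.cong (λ t → ι (chooseDiff t n i)) (ℕ.*-suc K i)))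
                              (trans (reflexive (≡.cong (x ^_) (ℕ.*-suc (suc K) i)))
                                     (^-distribˡ-+-* x (suc K) (suc K *ℕ i))))
                      (*-comm _ _)

    vandermonde-shifted : ∀ n i → Σ< (suc n) (λ r → ι (chooseDiff K K r) * ι (chooseDiff (K *ℕ i) n (r +ℕ i)))
                                  ≈ ι (chooseDiff (K +ℕ K *ℕ i) n i)
    vandermonde-shifted n i with i ℕ.≤? n
    ... | yes i≤n = begin
      Σ< (suc n) (λ r → ι (chooseDiff K K r) * ι (chooseDiff (K *ℕ i) n (r +ℕ i)))
        ≈⟨ Σ<-cong (suc n) (λ r → *-congˡ {ι (chooseDiff K K r)} (ι-cong
             (≡.trans (≡.cong (chooseDiff (K *ℕ i) n) (ℕ.+-comm r i)) (≡.sym (chooseDiff-∸ (K *ℕ i) r i≤n))))) ⟩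
      Σ< (suc n) (λ r → ι (chooseDiff K K r) * ι (chooseDiff (K *ℕ i) (n ∸ i) r))
        ≈⟨ vandermonde K (K *ℕ i) (n ∸ i) (suc n) (s≤s (ℕ.m∸n≤m n i)) ⟩
      ι (choose (K +ℕ K *ℕ i) (n ∸ i))
        ≡⟨ ≡.cong ι (chooseDiff-≤ (K +ℕ K *ℕ i) i≤n) ⟨
      ι (chooseDiff (K +ℕ K *ℕ i) n i) ∎
    ... | no i≰n = trans
      (Σ<-0 (suc n) (λ r → trans (*-congˡ {ι (chooseDiff K K r)}
                                   (ι-cong (chooseDiff-< (K *ℕ i) (ℕ.<-≤-trans (ℕ.≰⇒> i≰n) (ℕ.m≤n+m i r)))))
                                 (zeroʳ _)))
      (sym (ι-cong (chooseDiff-< (K +ℕ K *ℕ i) (ℕ.≰⇒> i≰n))))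

    closedForm-recurrence : ∀ n →
      closedForm (suc n) ≈ Σ< (suc n) (λ r → binomialColumn r 0 * closedForm (n ∸ r))
    closedForm-recurrence n = sym (begin
      Σ< (suc n) (λ r → binomialColumn r 0 * closedForm (n ∸ r))
        ≈⟨ Σ<-cong< (suc n) (λ r r<1+n →
             trans (*-congˡ {binomialColumn r 0} (closedForm-∸ n r (ℕ.≤-pred r<1+n)))
                   (Σ<-*ˡ (suc n) (binomialColumn r 0) (term r))) ⟩
      Σ< (suc n) (λ r → Σ< (suc n) (λ i → binomialColumn r 0 * term r i))
        ≈⟨ Σ<-swap (suc n) (suc n) (λ r i → binomialColumn r 0 * term r i) ⟩
      Σ< (suc n) (λ i → Σ< (suc n) (λ r → binomialColumn r 0 * term r i))
        ≈⟨ Σ<-cong (suc n) (λ i → trans (Σ<-cong (suc n) (λ r → regroup r i))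
                                        (trans (sym (Σ<-*ˡ (suc n) (X * X^ i)
                                                  (λ r → ι (chooseDiff K K r) * ι (chooseDiff (K *ℕ i) n (r +ℕ i)))))
                                               (*-congˡ (vandermonde-shifted n i)))) ⟩
      Σ< (suc n) (λ i → (X * X^ i) * ι (chooseDiff (K +ℕ K *ℕ i) n i))
        ≈⟨ closedForm-suc n ⟨
      closedForm (suc n) ∎)
      where
      term : ℕ → ℕ → Carrier
      term r i = ι (chooseDiff (K *ℕ i) n (r +ℕ i)) * X^ i
      regroup : ∀ r i → binomialColumn r 0 * term r i
                        ≈ (X * X^ i) * (ι (chooseDiff K K r) * ι (chooseDiff (K *ℕ i) n (r +ℕ i)))
      regroup r i = solve 4 (λ a X b p → (a :* X) :* (b :* p) := (X :* p) :* (a :* b))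
                      refl (ι (chooseDiff K K r)) X (ι (chooseDiff (K *ℕ i) n (r +ℕ i))) (X^ i)

    detD≈closedForm : ∀ n → detD n ≈ closedForm n
    detD≈closedForm n = go n n ℕ.≤-refl
      where
      go : ∀ n p → p ≤ n → detD p ≈ closedForm p
      go n       zero    _         = sym closedForm-0
      go (suc n) (suc p) (s≤s p≤n) = begin
        detD (suc p)                                            ≈⟨ detD-recurrence p ⟩
        Σ< (suc p) (λ r → binomialColumn r 0 * detD (p ∸ r))
          ≈⟨ Σ<-cong (suc p) (λ r → *-congˡ {binomialColumn r 0}
                                             (go n (p ∸ r) (ℕ.≤-trans (ℕ.m∸n≤m p r) p≤n))) ⟩
        Σ< (suc p) (λ r → binomialColumn r 0 * closedForm (p ∸ r)) ≈⟨ closedForm-recurrence p ⟨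
        closedForm (suc p)                                      ∎

    fibTerm : ℕ → ℕ → Carrier
    fibTerm N j = if (suc K *ℕ j) ℕ.≤ᵇ N then ι (choose (N ∸ K *ℕ j) j) * x ^ (N ∸ suc K *ℕ j) else 0#

    fibTerm≈0-if-N<j : ∀ N j → N < j → fibTerm N j ≈ 0#
    fibTerm≈0-if-N<j N j N<j with (suc K *ℕ j) ℕ.≤ᵇ N in eq
    ... | true  = ⊥-elim (ℕ.<⇒≱ N<j (ℕ.≤-trans (ℕ.m≤m+n j (K *ℕ j))
                                              (ℕ.≤ᵇ⇒≤ (suc K *ℕ j) N (≡.subst T (≡.sym eq) _))))
    ... | false = refl

    fibTerm≈0-if-n<j : ∀ n j → n < j → fibTerm (K *ℕ n) j ≈ 0#
    fibTerm≈0-if-n<j n (suc j) (s≤s n≤j) with (suc K *ℕ suc j) ℕ.≤ᵇ (K *ℕ n)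
    ... | true  = trans (*-congʳ (reflexive (≡.cong (λ t → ι (choose t (suc j)))
                                                    (ℕ.m≤n⇒m∸n≡0 (ℕ.*-monoʳ-≤ K (ℕ.m≤n⇒m≤1+n n≤j))))))
                        (zeroˡ _)
    ... | false = refl

    x^-*-fibTerm : ∀ i j → x ^ (i +ℕ j) * fibTerm (K *ℕ (i +ℕ j)) j ≈ ι (choose (K *ℕ i) j) * X^ i
    x^-*-fibTerm i j with (suc K *ℕ j) ℕ.≤ᵇ (K *ℕ (i +ℕ j)) in eq
    ... | true = begin
      x ^ (i +ℕ j) * (ι (choose (K *ℕ (i +ℕ j) ∸ K *ℕ j) j) * x ^ (K *ℕ (i +ℕ j) ∸ suc K *ℕ j))
        ≈⟨ x[yz]≈y[xz] (x ^ (i +ℕ j)) _ _ ⟩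
      ι (choose (K *ℕ (i +ℕ j) ∸ K *ℕ j) j) * (x ^ (i +ℕ j) * x ^ (K *ℕ (i +ℕ j) ∸ suc K *ℕ j))
        ≈⟨ *-cong (ι-cong (≡.cong (λ t → choose t j) Ki+Kj∸Kj≡Ki)) (sym (^-distribˡ-+-* x (i +ℕ j) _)) ⟩
      ι (choose (K *ℕ i) j) * x ^ (i +ℕ j +ℕ (K *ℕ (i +ℕ j) ∸ suc K *ℕ j))
        ≡⟨ ≡.cong (λ t → ι (choose (K *ℕ i) j) * x ^ t) (i+j+[K[i+j]∸[1+K]j]≡[1+K]i K i j kj≤K[i+j]) ⟩
      ι (choose (K *ℕ i) j) * X^ i ∎
      where
      x[yz]≈y[xz] : ∀ a b c → a * (b * c) ≈ b * (a * c)
      x[yz]≈y[xz] = solve 3 (λ a b c → a :* (b :* c) := b :* (a :* c)) refl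
      Ki+Kj∸Kj≡Ki : K *ℕ (i +ℕ j) ∸ K *ℕ j ≡ K *ℕ i
      Ki+Kj∸Kj≡Ki = ≡.trans (≡.cong (_∸ K *ℕ j) (ℕ.*-distribˡ-+ K i j)) (ℕ.m+n∸n≡m (K *ℕ i) (K *ℕ j))
      kj≤K[i+j] : suc K *ℕ j ≤ K *ℕ (i +ℕ j)
      kj≤K[i+j] = ℕ.≤ᵇ⇒≤ (suc K *ℕ j) _ (≡.subst T (≡.sym eq) _)
    ... | false = trans (zeroʳ _) (sym (trans (*-congʳ (ι-cong (choose-< Ki<j))) (zeroˡ _)))
      where
      Ki<j : K *ℕ i < j
      Ki<j = K[i+j]<[1+K]j⇒Ki<j K i j (ℕ.≰⇒> (λ h → ≡.subst T eq (ℕ.≤⇒≤ᵇ h)))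

    fib≈closedForm : ∀ n → x ^ n * fib R (suc K) (K *ℕ n) x ≈ closedForm n
    fib≈closedForm n = begin
      x ^ n * Σupto R (K *ℕ n) (fibTerm (K *ℕ n))
        ≈⟨ *-congˡ (trans (sym (Σupto-zeros (K *ℕ n +ℕ n) (fibTerm (K *ℕ n)) (ℕ.m≤m+n (K *ℕ n) n)
                                             (fibTerm≈0-if-N<j (K *ℕ n))))
                          (Σupto-zeros (K *ℕ n +ℕ n) (fibTerm (K *ℕ n)) (ℕ.m≤n+m n (K *ℕ n))
                                       (fibTerm≈0-if-n<j n))) ⟩
      x ^ n * Σupto R n (fibTerm (K *ℕ n))
        ≈⟨ *-congˡ (Σupto-reverse n (fibTerm (K *ℕ n))) ⟩
      x ^ n * Σ< (suc n) (λ i → fibTerm (K *ℕ n) (n ∸ i))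
        ≈⟨ Σ<-*ˡ (suc n) (x ^ n) (λ i → fibTerm (K *ℕ n) (n ∸ i)) ⟩
      Σ< (suc n) (λ i → x ^ n * fibTerm (K *ℕ n) (n ∸ i))
        ≈⟨ Σ<-cong< (suc n) (λ i i<1+n → term≈ i (ℕ.≤-pred i<1+n)) ⟩
      closedForm n ∎
      where
      term≈ : ∀ i → i ≤ n → x ^ n * fibTerm (K *ℕ n) (n ∸ i) ≈ ι (chooseDiff (K *ℕ i) n i) * X^ i
      term≈ i i≤n = begin
        x ^ n * fibTerm (K *ℕ n) (n ∸ i)
          ≡⟨ ≡.cong (λ m → x ^ m * fibTerm (K *ℕ m) (n ∸ i)) (ℕ.m+[n∸m]≡n i≤n) ⟨
        x ^ (i +ℕ (n ∸ i)) * fibTerm (K *ℕ (i +ℕ (n ∸ i))) (n ∸ i)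
          ≈⟨ x^-*-fibTerm i (n ∸ i) ⟩
        ι (choose (K *ℕ i) (n ∸ i)) * X^ i
          ≡⟨ ≡.cong (λ t → ι t * X^ i) (chooseDiff-≤ (K *ℕ i) i≤n) ⟨
        ι (chooseDiff (K *ℕ i) n i) * X^ i ∎

    det-Dmat : ∀ n → det R n (Dmat R (suc K) n x) ≈ x ^ n * fib R (suc K) (K *ℕ n) x
    det-Dmat n = begin
      det R n (Dmat R (suc K) n x) ≈⟨ det-cong n (λ i j → Dmat≈entryWith (toℕ i) (toℕ j)) ⟩
      detD n                       ≈⟨ detD≈closedForm n ⟩
      closedForm n                 ≈⟨ fib≈closedForm n ⟨
      x ^ n * fib R (suc K) (K *ℕ n) x ∎
      where
      Dmat≈entryWith : ∀ i c → ι (choose (i +ℕ suc K ∸ 1) (c +ℕ suc K ∸ 1)) * X - ι (chooseShift R i c)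
                               ≈ entryWith firstColumn i c
      Dmat≈entryWith i c = trans (reflexive (≡.cong₂ (λ a b → ι (choose a b) * X - ι (chooseShift R i c))
                                                      (≡.cong (_∸ 1) (ℕ.+-suc i K)) (≡.cong (_∸ 1) (ℕ.+-suc c K))))
                                 (entry≈entryWith i c)

open import Data.Nat using (_*_)

theorem4 : {c ℓ : Level} (R : CommutativeRing c ℓ) (k n : ℕ) → 1 ≤ k →
    (x : CommutativeRing.Carrier R) →
    CommutativeRing._≈_ R (det R n (Dmat R k n x))
      (CommutativeRing._*_ R (pow R x n) (fib R k ((k Data.Nat.∸ 1) * n) x))
theorem4 R (suc K) n (s≤s z≤n) x = det-Dmat R K x n
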